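{- For every $n\ge 0$ and every $k\ge 0$, the number of paths in $\mathcal M_n(UU)$ having exactly $k$ low peaks equals the number of paths in $\mathcal M_{n+1}(UD)$ whose final descent has length exactly $k$. In particular, the number of paths in $\mathcal M_n(UU)$ with no low peaks equals $|\mathcal M_n(UD)|$.
   Context: A Motzkin path of length $n$ is a lattice path from $(0,0)$ to $(n,0)$ with steps $U=(1,1)$, $F=(1,0)$, $D=(1,-1)$ that never goes below the $x$-axis, viewed as a word in $U,F,D$. An occurrence of a word $w$ in a path is a position where $w$ appears as a block of consecutive steps. $\mathcal M_n(w_1,\dots,w_r)$ denotes the set of Motzkin paths of length $n$ containing no occurrence of any of $w_1,\dots,w_r$. A peak is an occurrence of $UD$; a low peak is a peak whose downstep ends at height $0$ (returns the path to ground level). The final descent of a path is the maximal terminal run of $D$ steps; its length is $0$ if the path ends with $F$ or is empty. -}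

module Defs where

open import Data.Nat using (ℕ; zero; suc; _+_; _≡ᵇ_)
open import Data.Bool using (Bool; true; false; _∧_; _∨_; not; if_then_else_)
open import Data.List using (List; []; _∷_; length; filter; map; concatMap; reverse)
open import Data.Maybe using (Maybe; just; nothing)
open import Relation.Nullary.Decidable using (Dec)
open import Data.Bool.Properties using (T?)

-- Steps U=(1,1), F=(1,0), D=(1,-1)
data Step : Set where
  U F D : Step

Word : Set
Word = List Step

words : ℕ → List Word
words zero = [] ∷ []
words (suc n) = concatMap (λ w → (U ∷ w) ∷ (F ∷ w) ∷ (D ∷ w) ∷ []) (words n)

walk : ℕ → Word → Maybe ℕ
walk h [] = just h
walk h (U ∷ w) = walk (suc h) w
walk h (F ∷ w) = walk h w
walk zero (D ∷ w) = nothing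
walk (suc h) (D ∷ w) = walk h w

isMotzkin : Word → Bool
isMotzkin w with walk 0 w
... | just zero = true
... | _ = false

stepEq : Step → Step → Bool
stepEq U U = true
stepEq F F = true
stepEq D D = true
stepEq _ _ = false

isPrefix : Word → Word → Bool
isPrefix [] _ = true
isPrefix (a ∷ v) [] = false
isPrefix (a ∷ v) (b ∷ w) = stepEq a b ∧ isPrefix v w

occurs : Word → Word → Bool
occurs v [] = isPrefix v []
occurs v (b ∷ w) = isPrefix v (b ∷ w) ∨ occurs v w

avoidsAll : List Word → Word → Bool
avoidsAll [] w = true
avoidsAll (v ∷ vs) w = not (occurs v w) ∧ avoidsAll vs w

M : ℕ → List Word → List Word
M n ws = filter (λ w → T? (isMotzkin w ∧ avoidsAll ws w)) (words n)

-- number of low peaks: occurrences of UD whose D ends at height 0,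
-- i.e. U starting at height 0 immediately followed by D.
lowPeaksFrom : ℕ → Word → ℕ
lowPeaksFrom h [] = 0
lowPeaksFrom zero (U ∷ D ∷ w) = suc (lowPeaksFrom zero w)
lowPeaksFrom h (U ∷ w) = lowPeaksFrom (suc h) w
lowPeaksFrom h (F ∷ w) = lowPeaksFrom h w
lowPeaksFrom zero (D ∷ w) = lowPeaksFrom zero w
lowPeaksFrom (suc h) (D ∷ w) = lowPeaksFrom h w

lowPeaks : Word → ℕ
lowPeaks = lowPeaksFrom 0

leadingDs : Word → ℕ
leadingDs (D ∷ w) = suc (leadingDs w)
leadingDs _ = 0

finalDescent : Word → ℕ
finalDescent w = leadingDs (reverse w)

UU UD : Word
UU = U ∷ U ∷ []
UD = U ∷ D ∷ []

countWith : (Word → ℕ) → ℕ → List Word → ℕ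
countWith f k ws = length (filter (λ w → T? (f w ≡ᵇ k)) ws)

open import Relation.Binary.PropositionalEquality using (_≡_; refl)
_ : length (M 4 []) ≡ 9
_ = refl
_ : length (M 4 (UU ∷ [])) ≡ 8
_ = refl
_ : lowPeaks (U ∷ D ∷ U ∷ U ∷ D ∷ D ∷ U ∷ D ∷ []) ≡ 2
_ = refl
_ : finalDescent (U ∷ U ∷ D ∷ D ∷ []) ≡ 2
_ = refl
_ : countWith lowPeaks 1 (M 5 (UU ∷ [])) ≡ countWith finalDescent 1 (M 6 (UD ∷ []))
_ = refl
_ : countWith lowPeaks 0 (M 6 (UU ∷ [])) ≡ length (M 6 (UD ∷ []))
_ = refl

-- A UU-avoiding Motzkin path is a word in F, UD (a peak), UF and D. Translate it
-- step by step: F ↦ F, a peak UD ↦ U, UF ↦ U, and a D closing a level on which k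
-- peaks occurred since the level was entered ↦ F Dᵏ D. The down-steps of peaks
-- are thus postponed to the closing of their level; the k low peaks are never
-- closed and become the final descent of an appended F Dᵏ. The image is a
-- UD-avoiding Motzkin path one step longer whose final descent counts the low
-- peaks, and reading it backwards recovers the peak counters, hence the path.
-- Paths of this kind with final descent 0 are exactly the UD-avoiding paths of
-- length n followed by F.
module Submission where

open import Defs
open import Data.Bool using (true; false; T; _∧_)
open import Data.Bool.Properties using (T?; T-∧; T-∨; T-≡; T-not-≡; ⇔→≡; ∧-identityʳ)
open import Data.Empty using (⊥-elim)
open import Data.List using (List; []; _∷_; _++_; _∷ʳ_; _ʳ++_; length; reverse; replicate; map; filter; drop)
open import Data.List.Membership.Propositional using (_∈_)
open import Data.List.Membership.Propositional.Properties
  using (∈-map⁺; ∈-map⁻; ∈-filter⁺; ∈-filter⁻; ∈-concat⁺′; ∈-concat⁻′)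
open import Data.List.Membership.Propositional.Properties.WithK using (unique∧set⇒bag)
open import Data.List.Properties
  using (ʳ++-defn; unfold-reverse; reverse-++; reverse-involutive; length-++; length-replicate;
         length-reverse; length-map; map-∘; map-id-local)
open import Data.List.Relation.Binary.BagAndSetEquality using (∼bag⇒↭)
open import Data.List.Relation.Binary.Disjoint.Propositional using (Disjoint)
open import Data.List.Relation.Binary.Permutation.Propositional.Properties using (↭-length)
open import Data.List.Relation.Unary.All as All using ([]; _∷_)
open import Data.List.Relation.Unary.AllPairs as AllPairs using ([]; _∷_)
import Data.List.Relation.Unary.AllPairs.Properties as AllPairs
open import Data.List.Relation.Unary.Any using (here; there)
open import Data.List.Relation.Unary.Unique.Propositional using (Unique)
import Data.List.Relation.Unary.Unique.Propositional.Properties as Unique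
open import Data.Maybe using (Maybe; just; nothing; _>>=_)
open import Data.Maybe.Properties using (just-injective)
open import Data.Nat using (ℕ; zero; suc; _+_; _<_; _≡ᵇ_; z<s)
open import Data.Nat.Properties using (+-suc; +-identityʳ; +-comm; suc-injective; m+1+n≢0; ≡ᵇ⇒≡; ≡⇒≡ᵇ)
open import Data.Nat.Tactic.RingSolver using (solve-∀)
open import Data.Product using (_×_; _,_; proj₁; proj₂; ∃; ∃₂)
open import Data.Product.Function.NonDependent.Propositional using (_×-⇔_)
open import Data.Sum using (inj₁; inj₂)
open import Data.Unit using (tt)
open import Data.Vec using (Vec; []; _∷_; last)
open import Function using (_∘_)
open import Function.Bundles using (_⇔_; mk⇔; Equivalence)
import Function.Properties.Equivalence as ⇔
open import Relation.Binary.PropositionalEquality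
open import Relation.Unary using (Decidable)

-- Finite sets of words and bijections

module _ {A : Set} where

  record Enumerates (P : A → Set) (xs : List A) : Set where
    field
      unique : Unique xs
      ∈⇔    : ∀ {x} → x ∈ xs ⇔ P x

  open Enumerates

  Enumerates-⇔ : ∀ {P Q : A → Set} {xs} → (∀ {x} → P x ⇔ Q x) → Enumerates P xs → Enumerates Q xs
  Enumerates-⇔ P⇔Q e = record { unique = unique e ; ∈⇔ = ⇔.trans (∈⇔ e) P⇔Q }

  filter-enumerates : ∀ {P Q : A → Set} {xs} (Q? : Decidable Q) → Enumerates P xs →
    Enumerates (λ x → P x × Q x) (filter Q? xs)
  filter-enumerates Q? e = record
    { unique = Unique.filter⁺ Q? (unique e)
    ; ∈⇔    = mk⇔ (λ x∈ → let x∈xs , q = ∈-filter⁻ Q? x∈ in Equivalence.to (∈⇔ e) x∈xs , q)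
                  (λ (p , q) → ∈-filter⁺ Q? (Equivalence.from (∈⇔ e) p) q)
    }

  enumerates-length : ∀ {P Q : A → Set} {xs ys} → Enumerates P xs → Enumerates Q ys → (f g : A → A) →
    (∀ {x} → P x → Q (f x) × g (f x) ≡ x) → (∀ {y} → Q y → P (g y) × f (g y) ≡ y) →
    length xs ≡ length ys
  enumerates-length {xs = xs} {ys} exs eys f g f-inv g-inv =
    trans (sym (length-map f xs)) (↭-length (∼bag⇒↭ (unique∧set⇒bag unique-map (unique eys) same-elements)))
    where
    g∘f≡id : map g (map f xs) ≡ xs
    g∘f≡id = trans (sym (map-∘ xs))
      (map-id-local (All.tabulate (λ x∈ → proj₂ (f-inv (Equivalence.to (∈⇔ exs) x∈)))))
    unique-map : Unique (map f xs)
    unique-map = Unique.map⁻ (subst Unique (sym g∘f≡id) (unique exs))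
    same-elements : ∀ {z} → z ∈ map f xs ⇔ z ∈ ys
    same-elements = mk⇔
      (λ z∈ → let x , x∈ , z≡fx = ∈-map⁻ f z∈ in
        subst (_∈ ys) (sym z≡fx) (Equivalence.from (∈⇔ eys) (proj₁ (f-inv (Equivalence.to (∈⇔ exs) x∈)))))
      (λ z∈ → let q = Equivalence.to (∈⇔ eys) z∈ in
        subst (_∈ map f xs) (proj₂ (g-inv q)) (∈-map⁺ f (Equivalence.from (∈⇔ exs) (proj₁ (g-inv q)))))

open Enumerates

extensions : Word → List Word
extensions w = (U ∷ w) ∷ (F ∷ w) ∷ (D ∷ w) ∷ []

∈-extensions⁻ : ∀ {v w} → v ∈ extensions w → ∃ λ s → v ≡ s ∷ w
∈-extensions⁻ (here refl)                 = U , refl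
∈-extensions⁻ (there (here refl))         = F , refl
∈-extensions⁻ (there (there (here refl))) = D , refl

∈-extensions⁺ : ∀ s w → (s ∷ w) ∈ extensions w
∈-extensions⁺ U w = here refl
∈-extensions⁺ F w = there (here refl)
∈-extensions⁺ D w = there (there (here refl))

words-enumerates : ∀ n → Enumerates (λ w → length w ≡ n) (words n)
words-enumerates n = record { unique = words-unique n ; ∈⇔ = mk⇔ (∈-words⁻ n) (∈-words⁺ n _) }
  where
  ∈-words⁻ : ∀ n {w} → w ∈ words n → length w ≡ n
  ∈-words⁻ zero    (here refl) = refl
  ∈-words⁻ (suc n) w∈ with ∈-concat⁻′ (map extensions (words n)) w∈
  ... | vs , w∈vs , vs∈ with ∈-map⁻ extensions vs∈
  ... | v , v∈ , refl with ∈-extensions⁻ w∈vs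
  ... | s , refl = cong suc (∈-words⁻ n v∈)
  ∈-words⁺ : ∀ n w → length w ≡ n → w ∈ words n
  ∈-words⁺ zero    []      refl = here refl
  ∈-words⁺ (suc n) (s ∷ w) refl = ∈-concat⁺′ (∈-extensions⁺ s w) (∈-map⁺ extensions (∈-words⁺ n w refl))
  words-unique : ∀ n → Unique (words n)
  words-unique zero    = [] ∷ []
  words-unique (suc n) =
    Unique.concat⁺ (All.tabulate unique-extensions) (AllPairs.map⁺ (AllPairs.map disjoint (words-unique n)))
    where
    unique-extensions : ∀ {vs} → vs ∈ map extensions (words n) → Unique vs
    unique-extensions vs∈ with ∈-map⁻ extensions vs∈
    ... | w , _ , refl = ((λ ()) ∷ (λ ()) ∷ []) ∷ ((λ ()) ∷ []) ∷ [] ∷ []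
    disjoint : ∀ {v w} → v ≢ w → Disjoint (extensions v) (extensions w)
    disjoint v≢w (v∈ , w∈) with ∈-extensions⁻ v∈ | ∈-extensions⁻ w∈
    ... | s , refl | t , refl = v≢w refl

MotzkinAvoiding : Word → Word → Set
MotzkinAvoiding v w = walk 0 w ≡ just 0 × occurs v w ≡ false

InM : ℕ → Word → Word → Set
InM n v w = length w ≡ n × MotzkinAvoiding v w

T-isMotzkin : ∀ w → T (isMotzkin w) ⇔ walk 0 w ≡ just 0
T-isMotzkin w with walk 0 w
... | just zero    = mk⇔ (λ _ → refl) (λ _ → tt)
... | just (suc _) = mk⇔ (λ ()) (λ ())
... | nothing      = mk⇔ (λ ()) (λ ())

T-motzkinAvoiding : ∀ v w → T (isMotzkin w ∧ avoidsAll (v ∷ []) w) ⇔ MotzkinAvoiding v w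
T-motzkinAvoiding v w =
  ⇔.trans T-∧ (T-isMotzkin w ×-⇔ subst (λ b → T b ⇔ occurs v w ≡ false) (sym (∧-identityʳ _)) T-not-≡)

M-enumerates : ∀ n v → Enumerates (InM n v) (M n (v ∷ []))
M-enumerates n v =
  Enumerates-⇔ (λ {w} → ⇔.refl ×-⇔ T-motzkinAvoiding v w)
    (filter-enumerates (λ w → T? _) (words-enumerates n))

countWith-enumerates : ∀ {P xs} (st : Word → ℕ) k → Enumerates P xs →
  Enumerates (λ w → P w × st w ≡ k) (filter (λ w → T? (st w ≡ᵇ k)) xs)
countWith-enumerates st k e =
  Enumerates-⇔ (λ {w} → ⇔.refl ×-⇔ mk⇔ (≡ᵇ⇒≡ (st w) k) (≡⇒≡ᵇ (st w) k))
    (filter-enumerates (λ w → T? _) e)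

-- Reading paths backwards

-- walkBack m v is the height at which reverse v must start in order to end at height m.
walkBack : ℕ → Word → Maybe ℕ
walkBack m       []      = just m
walkBack m       (F ∷ v) = walkBack m v
walkBack m       (D ∷ v) = walkBack (suc m) v
walkBack zero    (U ∷ v) = nothing
walkBack (suc m) (U ∷ v) = walkBack m v

walk-++ : ∀ h xs ys → walk h (xs ++ ys) ≡ (walk h xs >>= λ m → walk m ys)
walk-++ h       []       ys = refl
walk-++ h       (U ∷ xs) ys = walk-++ (suc h) xs ys
walk-++ h       (F ∷ xs) ys = walk-++ h xs ys
walk-++ zero    (D ∷ xs) ys = refl
walk-++ (suc h) (D ∷ xs) ys = walk-++ h xs ys

walk-reverse-∷ : ∀ h s v → walk h (reverse (s ∷ v)) ≡ (walk h (reverse v) >>= λ m → walk m (s ∷ []))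
walk-reverse-∷ h s v = trans (cong (walk h) (unfold-reverse s v)) (walk-++ h (reverse v) (s ∷ []))

walkBack⇒walk-reverse : ∀ v {m h} → walkBack m v ≡ just h → walk h (reverse v) ≡ just m
walkBack⇒walk-reverse []      refl = refl
walkBack⇒walk-reverse (s ∷ v) {m} {h} p = trans (walk-reverse-∷ h s v) (last-step s m p)
  where
  last-step : ∀ s m → walkBack m (s ∷ v) ≡ just h →
    (walk h (reverse v) >>= λ m′ → walk m′ (s ∷ [])) ≡ just m
  last-step F m       p rewrite walkBack⇒walk-reverse v p = refl
  last-step D m       p rewrite walkBack⇒walk-reverse v p = refl
  last-step U (suc m) p rewrite walkBack⇒walk-reverse v p = refl

walk-reverse⇒walkBack : ∀ v {m h} → walk h (reverse v) ≡ just m → walkBack m v ≡ just h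
walk-reverse⇒walkBack []      refl = refl
walk-reverse⇒walkBack (s ∷ v) {m} {h} p =
  last-step s (walk h (reverse v)) refl (trans (sym (walk-reverse-∷ h s v)) p)
  where
  last-step : ∀ s r → walk h (reverse v) ≡ r → (r >>= λ m′ → walk m′ (s ∷ [])) ≡ just m →
    walkBack m (s ∷ v) ≡ just h
  last-step F (just m′)       e refl = walk-reverse⇒walkBack v e
  last-step D (just (suc m′)) e refl = walk-reverse⇒walkBack v e
  last-step U (just m′)       e refl = walk-reverse⇒walkBack v e

stepEq⇒≡ : ∀ a b → T (stepEq a b) → a ≡ b
stepEq⇒≡ U U _ = refl
stepEq⇒≡ F F _ = refl
stepEq⇒≡ D D _ = refl

stepEq-refl : ∀ a → T (stepEq a a)
stepEq-refl U = tt
stepEq-refl F = tt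
stepEq-refl D = tt

isPrefix-pair : ∀ a b w → T (isPrefix (a ∷ b ∷ []) w) → ∃ λ ys → w ≡ a ∷ b ∷ ys
isPrefix-pair a b (c ∷ []) t = ⊥-elim (proj₂ (Equivalence.to (T-∧ {stepEq a c}) t))
isPrefix-pair a b (c ∷ d ∷ ys) t
  with ac , bd′ ← Equivalence.to (T-∧ {stepEq a c}) t
  with bd , _ ← Equivalence.to (T-∧ {stepEq b d}) bd′
  with refl ← stepEq⇒≡ a c ac | refl ← stepEq⇒≡ b d bd = ys , refl

occurs-pair⇒split : ∀ a b w → T (occurs (a ∷ b ∷ []) w) → ∃₂ λ xs ys → w ≡ xs ++ a ∷ b ∷ ys
occurs-pair⇒split a b (c ∷ w) t with Equivalence.to (T-∨ {isPrefix (a ∷ b ∷ []) (c ∷ w)}) t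
... | inj₁ prefix = let ys , e = isPrefix-pair a b (c ∷ w) prefix in [] , ys , e
... | inj₂ later  = let xs , ys , e = occurs-pair⇒split a b w later in c ∷ xs , ys , cong (c ∷_) e

split⇒occurs-pair : ∀ a b xs ys → T (occurs (a ∷ b ∷ []) (xs ++ a ∷ b ∷ ys))
split⇒occurs-pair a b []       ys =
  Equivalence.from T-∨ (inj₁ (Equivalence.from T-∧ (stepEq-refl a , Equivalence.from T-∧ (stepEq-refl b , tt))))
split⇒occurs-pair a b (x ∷ xs) ys = Equivalence.from T-∨ (inj₂ (split⇒occurs-pair a b xs ys))

reverse-split : ∀ xs (a b : Step) ys → reverse (xs ++ a ∷ b ∷ ys) ≡ reverse ys ++ b ∷ a ∷ reverse xs
reverse-split xs a b ys = begin
  reverse (xs ++ a ∷ b ∷ ys)         ≡⟨ reverse-++ xs (a ∷ b ∷ ys) ⟩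
  reverse (a ∷ b ∷ ys) ++ reverse xs ≡⟨ ʳ++-defn (a ∷ b ∷ ys) ⟨
  ys ʳ++ (b ∷ a ∷ reverse xs)        ≡⟨ ʳ++-defn ys ⟩
  reverse ys ++ b ∷ a ∷ reverse xs   ∎
  where open ≡-Reasoning

occurs-reverse : ∀ a b v → occurs (a ∷ b ∷ []) (reverse v) ≡ occurs (b ∷ a ∷ []) v
occurs-reverse a b v = ⇔→≡ (mk⇔ to from)
  where
  to : occurs (a ∷ b ∷ []) (reverse v) ≡ true → occurs (b ∷ a ∷ []) v ≡ true
  to t = let xs , ys , e = occurs-pair⇒split a b (reverse v) (Equivalence.from T-≡ t) in
    Equivalence.to T-≡ (subst (T ∘ occurs (b ∷ a ∷ []))
      (trans (sym (reverse-split xs a b ys)) (trans (cong reverse (sym e)) (reverse-involutive v)))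
      (split⇒occurs-pair b a (reverse ys) (reverse xs)))
  from : occurs (b ∷ a ∷ []) v ≡ true → occurs (a ∷ b ∷ []) (reverse v) ≡ true
  from t = let xs , ys , e = occurs-pair⇒split b a v (Equivalence.from T-≡ t) in
    Equivalence.to T-≡ (subst (T ∘ occurs (a ∷ b ∷ []))
      (sym (trans (cong reverse e) (reverse-split xs b a ys)))
      (split⇒occurs-pair a b (reverse ys) (reverse xs)))

RevMotzkinAvoiding : Word → Word → Set
RevMotzkinAvoiding v u = walkBack 0 u ≡ just 0 × occurs v u ≡ false

walk-reverse⇔ : ∀ v {m h} → walk h (reverse v) ≡ just m ⇔ walkBack m v ≡ just h
walk-reverse⇔ v = mk⇔ (walk-reverse⇒walkBack v) (walkBack⇒walk-reverse v)

MotzkinAvoiding-reverse : ∀ a b y →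
  MotzkinAvoiding (a ∷ b ∷ []) y ⇔ RevMotzkinAvoiding (b ∷ a ∷ []) (reverse y)
MotzkinAvoiding-reverse a b y = walks ×-⇔ avoids
  where
  walks : walk 0 y ≡ just 0 ⇔ walkBack 0 (reverse y) ≡ just 0
  walks = subst (λ x → walk 0 x ≡ just 0 ⇔ walkBack 0 (reverse y) ≡ just 0)
                (reverse-involutive y) (walk-reverse⇔ (reverse y))
  occurs≡ : occurs (a ∷ b ∷ []) y ≡ occurs (b ∷ a ∷ []) (reverse y)
  occurs≡ = trans (cong (occurs (a ∷ b ∷ [])) (sym (reverse-involutive y))) (occurs-reverse a b (reverse y))
  avoids : occurs (a ∷ b ∷ []) y ≡ false ⇔ occurs (b ∷ a ∷ []) (reverse y) ≡ false
  avoids = subst (λ o → occurs (a ∷ b ∷ []) y ≡ false ⇔ o ≡ false) occurs≡ ⇔.refl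

-- Encoding and decoding

-- The peak counters of the levels h, h - 1, …, 0 entered so far, topmost first.
Stack : ℕ → Set
Stack h = Vec ℕ (suc h)

heightBelow : ∀ {h} → Vec ℕ h → ℕ
heightBelow []      = 0
heightBelow (j ∷ S) = suc (j + heightBelow S)

-- The height reached by the image: one pending U per counted peak and per entered level above 0.
height : ∀ {h} → Stack h → ℕ
height (k ∷ S) = k + heightBelow S

-- encode S w r is the reversed image of w prepended to r; decode S v acc reads a
-- reversed image and prepends the recovered steps to acc. Their last clauses are junk.
encode : ∀ {h} → Stack h → Word → Word → Word
encode (k ∷ S)     (F ∷ w)     r = encode (k ∷ S) w (F ∷ r)
encode (k ∷ S)     (U ∷ D ∷ w) r = encode (suc k ∷ S) w (U ∷ r)
encode (k ∷ S)     (U ∷ F ∷ w) r = encode (0 ∷ k ∷ S) w (U ∷ r)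
encode (k ∷ j ∷ S) (D ∷ w)     r = encode (j ∷ S) w (D ∷ replicate k D ++ F ∷ r)
encode (k ∷ [])    []          r = replicate k D ++ F ∷ r
encode _           _           _ = []

decode : ∀ {h} → Stack h → Word → Word → Word
decodeClose : ∀ {h} → Stack h → ℕ → Word → Word → Word
decode S           []      acc = acc
decode S           (F ∷ v) acc = decode S v (F ∷ acc)
decode (suc c ∷ S) (U ∷ v) acc = decode (c ∷ S) v (U ∷ D ∷ acc)
decode (0 ∷ k ∷ S) (U ∷ v) acc = decode (k ∷ S) v (U ∷ F ∷ acc)
decode (0 ∷ [])    (U ∷ v) acc = []
decode S           (D ∷ v) acc = decodeClose S 0 v acc
decodeClose S m (D ∷ v) acc = decodeClose S (suc m) v acc
decodeClose S m (F ∷ v) acc = decode (m ∷ S) v (D ∷ acc)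
decodeClose S m _       acc = []

decodeStart : ℕ → Word → Word
decodeStart m (D ∷ u) = decodeStart (suc m) u
decodeStart m (F ∷ v) = decode (m ∷ []) v []
decodeStart m _       = []

toUDFree : Word → Word
toUDFree w = reverse (encode (0 ∷ []) w [])

toUUFree : Word → Word
toUUFree y = decodeStart 0 (reverse y)

-- The two kinds of paths as grammars

data UUFreeFrom : ℕ → Word → Set where
  end  : UUFreeFrom 0 []
  flat : ∀ {h w} → UUFreeFrom h w → UUFreeFrom h (F ∷ w)
  peak : ∀ {h w} → UUFreeFrom h w → UUFreeFrom h (U ∷ D ∷ w)
  up   : ∀ {h w} → UUFreeFrom (suc h) w → UUFreeFrom h (U ∷ F ∷ w)
  down : ∀ {h w} → UUFreeFrom h w → UUFreeFrom (suc h) (D ∷ w)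

UUFreeFrom⇔ : ∀ h w → UUFreeFrom h w ⇔ (walk h w ≡ just 0 × occurs UU w ≡ false)
UUFreeFrom⇔ h w = mk⇔ (λ p → walks p , avoids p) (λ (p , q) → parse h w p q)
  where
  walks : ∀ {h w} → UUFreeFrom h w → walk h w ≡ just 0
  walks end      = refl
  walks (flat p) = walks p
  walks (peak p) = walks p
  walks (up p)   = walks p
  walks (down p) = walks p
  avoids : ∀ {h w} → UUFreeFrom h w → occurs UU w ≡ false
  avoids end      = refl
  avoids (flat p) = avoids p
  avoids (peak p) = avoids p
  avoids (up p)   = avoids p
  avoids (down p) = avoids p
  parse : ∀ h w → walk h w ≡ just 0 → occurs UU w ≡ false → UUFreeFrom h w
  parse zero    []          p q = end
  parse h       (F ∷ w)     p q = flat (parse h w p q)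
  parse h       (U ∷ D ∷ w) p q = peak (parse h w p q)
  parse h       (U ∷ F ∷ w) p q = up (parse (suc h) w p q)
  parse (suc h) (D ∷ w)     p q = down (parse h w p q)

DU : Word
DU = D ∷ U ∷ []

-- A factor D Dᵐ F of v is the reversed image of a D closing a level after m peaks.
data RevUDFree : ∀ {h} → Stack h → Word → Set where
  end  : RevUDFree (0 ∷ []) []
  flat : ∀ {h} {S : Stack h} {v} → RevUDFree S v → RevUDFree S (F ∷ v)
  peak : ∀ {h c} {S : Vec ℕ h} {v} → RevUDFree (c ∷ S) v → RevUDFree (suc c ∷ S) (U ∷ v)
  up   : ∀ {h} {S : Stack h} {v} → RevUDFree S v → RevUDFree (0 ∷ S) (U ∷ v)
  down : ∀ {h m} {S : Stack h} {v} → RevUDFree (m ∷ S) v → RevUDFree S (D ∷ replicate m D ++ F ∷ v)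

data RevUDFreeDescent : ℕ → Word → Set where
  start : ∀ {k v} → RevUDFree (k ∷ []) v → RevUDFreeDescent k (replicate k D ++ F ∷ v)

subst-descent : ∀ {i j u} → i ≡ j → RevUDFreeDescent i u → RevUDFreeDescent j u
subst-descent refl d = d

replicate-++-∷ : ∀ k (s : Step) v → replicate k s ++ s ∷ v ≡ s ∷ replicate k s ++ v
replicate-++-∷ zero    s v = refl
replicate-++-∷ (suc k) s v = cong (s ∷_) (replicate-++-∷ k s v)

walkBack-descent : ∀ k j v → walkBack j (replicate k D ++ v) ≡ walkBack (k + j) v
walkBack-descent zero    j v = refl
walkBack-descent (suc k) j v = trans (walkBack-descent k (suc j) v) (cong (λ i → walkBack i v) (+-suc k j))

occurs-DU-descent : ∀ k v → occurs DU (replicate k D ++ F ∷ v) ≡ occurs DU v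
occurs-DU-descent zero          v = refl
occurs-DU-descent (suc zero)    v = refl
occurs-DU-descent (suc (suc k)) v = occurs-DU-descent (suc k) v

leadingDs-descent : ∀ k v → leadingDs (replicate k D ++ F ∷ v) ≡ k
leadingDs-descent zero    v = refl
leadingDs-descent (suc k) v = cong suc (leadingDs-descent k v)

RevUDFree⇔ : ∀ {h} (S : Stack h) v →
  RevUDFree S v ⇔ (walkBack (height S) v ≡ just 0 × occurs DU v ≡ false)
RevUDFree⇔ S v = mk⇔ (λ p → walks p , avoids p) (λ (p , q) → parse S v p q)
  where
  walks : ∀ {h} {S : Stack h} {v} → RevUDFree S v → walkBack (height S) v ≡ just 0
  walks end                 = refl
  walks (flat p)            = walks p
  walks (peak p)            = walks p
  walks {S = 0 ∷ _ ∷ _} (up p) = walks p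
  walks {S = k ∷ S} (down {m = m} {v = v} p) =
    trans (walkBack-descent m (suc (height (k ∷ S))) (F ∷ v)) (walks p)
  avoids : ∀ {h} {S : Stack h} {v} → RevUDFree S v → occurs DU v ≡ false
  avoids end      = refl
  avoids (flat p) = avoids p
  avoids (peak p) = avoids p
  avoids (up p)   = avoids p
  avoids (down {m = m} {v = v} p) = trans (occurs-DU-descent (suc m) v) (avoids p)
  parse : ∀ {h} (S : Stack h) v → walkBack (height S) v ≡ just 0 → occurs DU v ≡ false → RevUDFree S v
  parseClose : ∀ {h} (S : Stack h) j v → walkBack (j + suc (height S)) v ≡ just 0 → occurs DU (D ∷ v) ≡ false →
    RevUDFree S (D ∷ replicate j D ++ v)
  parse (0 ∷ [])    []      p q = end
  parse (k ∷ j ∷ S) []      p q = ⊥-elim (m+1+n≢0 k (just-injective p))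
  parse S           (F ∷ v) p q = flat (parse S v p q)
  parse (suc c ∷ S) (U ∷ v) p q = peak (parse (c ∷ S) v p q)
  parse (0 ∷ k ∷ S) (U ∷ v) p q = up (parse (k ∷ S) v p q)
  parse S           (D ∷ v) p q = parseClose S 0 v p q
  parseClose S       j []      p q = ⊥-elim (m+1+n≢0 j (just-injective p))
  parseClose (k ∷ S) j (F ∷ v) p q = down (parse (j ∷ k ∷ S) v p q)
  parseClose S       j (D ∷ v) p q =
    subst (λ x → RevUDFree S (D ∷ x)) (sym (replicate-++-∷ j D v)) (parseClose S (suc j) v p q)

RevUDFreeDescent⇒RevMotzkinAvoiding : ∀ {k u} → RevUDFreeDescent k u →
  RevMotzkinAvoiding DU u × leadingDs u ≡ k
RevUDFreeDescent⇒RevMotzkinAvoiding (start {k} {v} p) =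
  let walks , avoids = Equivalence.to (RevUDFree⇔ (k ∷ []) v) p in
  (trans (walkBack-descent k 0 (F ∷ v)) walks , trans (occurs-DU-descent k v) avoids) , leadingDs-descent k v

RevMotzkinAvoiding⇒RevUDFreeDescent : ∀ u → RevMotzkinAvoiding DU u → 0 < length u →
  RevUDFreeDescent (leadingDs u) u
RevMotzkinAvoiding⇒RevUDFreeDescent (F ∷ v) avoids _ = start (Equivalence.from (RevUDFree⇔ (0 ∷ []) v) avoids)
RevMotzkinAvoiding⇒RevUDFreeDescent (D ∷ v) (p , q) _ = descent 0 v p q
  where
  descent : ∀ j v → walkBack (suc j) v ≡ just 0 → occurs DU (D ∷ v) ≡ false →
    RevUDFreeDescent (suc j + leadingDs v) (D ∷ replicate j D ++ v)
  descent j (F ∷ v) p q =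
    let walks = subst (λ i → walkBack i v ≡ just 0) (sym (+-identityʳ (suc j))) p
    in subst-descent (sym (+-identityʳ (suc j))) (start (Equivalence.from (RevUDFree⇔ (suc j ∷ []) v) (walks , q)))
  descent j (D ∷ v) p q = subst (RevUDFreeDescent _) (cong (D ∷_) (sym (replicate-++-∷ j D v)))
    (subst-descent (sym (+-suc (suc j) (leadingDs v))) (descent (suc j) v p q))

decode-close : ∀ {h} (S : Stack h) m v acc →
  decode S (D ∷ replicate m D ++ F ∷ v) acc ≡ decode (m ∷ S) v (D ∷ acc)
decode-close S m v acc = trans (count 0 m) (cong (λ i → decode (i ∷ S) v (D ∷ acc)) (+-identityʳ m))
  where
  count : ∀ j m → decodeClose S j (replicate m D ++ F ∷ v) acc ≡ decode (m + j ∷ S) v (D ∷ acc)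
  count j zero    = refl
  count j (suc m) = trans (count (suc j) m) (cong (λ i → decode (i ∷ S) v (D ∷ acc)) (+-suc m j))

decodeStart-descent : ∀ k v → decodeStart 0 (replicate k D ++ F ∷ v) ≡ decode (k ∷ []) v []
decodeStart-descent k v = trans (count 0 k) (cong (λ i → decode (i ∷ []) v []) (+-identityʳ k))
  where
  count : ∀ j k → decodeStart j (replicate k D ++ F ∷ v) ≡ decode (k + j ∷ []) v []
  count j zero    = refl
  count j (suc k) = trans (count (suc j) k) (cong (λ i → decode (i ∷ []) v []) (+-suc k j))

decode-encode : ∀ {h w} → UUFreeFrom h w → (S : Stack h) (r : Word) →
  decodeStart 0 (encode S w r) ≡ decode S r w
decode-encode end      (k ∷ [])    r = decodeStart-descent k r
decode-encode (flat p) (k ∷ S)     r = decode-encode p (k ∷ S) (F ∷ r)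
decode-encode (peak p) (k ∷ S)     r = decode-encode p (suc k ∷ S) (U ∷ r)
decode-encode (up p)   (k ∷ S)     r = decode-encode p (0 ∷ k ∷ S) (U ∷ r)
decode-encode (down p) (k ∷ j ∷ S) r = trans (decode-encode p (j ∷ S) _) (decode-close (j ∷ S) k r _)

encode-decode : ∀ {h} {S : Stack h} {v} → RevUDFree S v → (acc : Word) →
  encode (0 ∷ []) (decode S v acc) [] ≡ encode S acc v
encode-decode end                    acc = refl
encode-decode {S = _ ∷ _} (flat p)   acc = encode-decode p (F ∷ acc)
encode-decode (peak p)               acc = encode-decode p (U ∷ D ∷ acc)
encode-decode {S = 0 ∷ _ ∷ _} (up p) acc = encode-decode p (U ∷ F ∷ acc)
encode-decode {S = k ∷ S} (down {m = m} {v = v} p) acc =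
  trans (cong (λ x → encode (0 ∷ []) x []) (decode-close (k ∷ S) m v acc)) (encode-decode p (D ∷ acc))

decode-UUFreeFrom : ∀ {h} {S : Stack h} {v acc} → RevUDFree S v → UUFreeFrom h acc →
  UUFreeFrom 0 (decode S v acc)
decode-UUFreeFrom end                    q = q
decode-UUFreeFrom (flat p)               q = decode-UUFreeFrom p (flat q)
decode-UUFreeFrom (peak p)               q = decode-UUFreeFrom p (peak q)
decode-UUFreeFrom {S = 0 ∷ _ ∷ _} (up p) q = decode-UUFreeFrom p (up q)
decode-UUFreeFrom {S = k ∷ S} (down {m = m} {v = v} p) q =
  subst (UUFreeFrom 0) (sym (decode-close (k ∷ S) m v _)) (decode-UUFreeFrom p (down q))

lowPeaksFrom-F : ∀ h w → lowPeaksFrom h (F ∷ w) ≡ lowPeaksFrom h w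
lowPeaksFrom-F zero    w = refl
lowPeaksFrom-F (suc h) w = refl

lowPeaksFrom-UF : ∀ h w → lowPeaksFrom h (U ∷ F ∷ w) ≡ lowPeaksFrom (suc h) w
lowPeaksFrom-UF zero    w = refl
lowPeaksFrom-UF (suc h) w = refl

last-+-lowPeaksFrom-UD : ∀ {h} (S : Vec ℕ h) k w →
  last (suc k ∷ S) + lowPeaksFrom h w ≡ last (k ∷ S) + lowPeaksFrom h (U ∷ D ∷ w)
last-+-lowPeaksFrom-UD []      k w = sym (+-suc k _)
last-+-lowPeaksFrom-UD (j ∷ S) k w = refl

encode-RevUDFreeDescent : ∀ {h w r} → UUFreeFrom h w → (S : Stack h) → RevUDFree S r →
  RevUDFreeDescent (last S + lowPeaksFrom h w) (encode S w r)
encode-RevUDFreeDescent end (k ∷ []) q = subst-descent (sym (+-identityʳ k)) (start q)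
encode-RevUDFreeDescent {h} {F ∷ w} (flat p) (k ∷ S) q =
  subst-descent (cong (last (k ∷ S) +_) (sym (lowPeaksFrom-F h w)))
    (encode-RevUDFreeDescent p (k ∷ S) (flat q))
encode-RevUDFreeDescent {h} {U ∷ D ∷ w} (peak p) (k ∷ S) q =
  subst-descent (last-+-lowPeaksFrom-UD S k w) (encode-RevUDFreeDescent p (suc k ∷ S) (peak q))
encode-RevUDFreeDescent {h} {U ∷ F ∷ w} (up p) (k ∷ S) q =
  subst-descent (cong (last (k ∷ S) +_) (sym (lowPeaksFrom-UF h w)))
    (encode-RevUDFreeDescent p (0 ∷ k ∷ S) (up q))
encode-RevUDFreeDescent (down p) (k ∷ j ∷ S) q = encode-RevUDFreeDescent p (j ∷ S) (down q)

length-descent : ∀ k r → length (replicate k D ++ F ∷ r) ≡ k + suc (length r)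
length-descent k r = trans (length-++ (replicate k D)) (cong (_+ suc (length r)) (length-replicate k))

length-encode : ∀ {h w} → UUFreeFrom h w → (S : Stack h) (r : Word) →
  length (encode S w r) ≡ length w + height S + suc (length r)
length-encode end (k ∷ []) r =
  trans (length-descent k r) (cong (_+ suc (length r)) (sym (+-identityʳ k)))
length-encode (flat {w = w} p) (k ∷ S) r =
  trans (length-encode p (k ∷ S) (F ∷ r)) (+-suc (length w + height (k ∷ S)) (suc (length r)))
length-encode (peak {w = w} p) (k ∷ S) r =
  trans (length-encode p (suc k ∷ S) (U ∷ r)) (shift (length w) (height (k ∷ S)) (length r))
  where
  shift : ∀ a b c → a + suc b + suc (suc c) ≡ suc (suc a) + b + suc c
  shift = solve-∀
length-encode (up {w = w} p) (k ∷ S) r =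
  trans (length-encode p (0 ∷ k ∷ S) (U ∷ r)) (shift (length w) (height (k ∷ S)) (length r))
  where
  shift : ∀ a b c → a + suc b + suc (suc c) ≡ suc (suc a) + b + suc c
  shift = solve-∀
length-encode (down {w = w} p) (k ∷ j ∷ S) r =
  trans (length-encode p (j ∷ S) _)
    (trans (cong (λ n → length w + height (j ∷ S) + suc (suc n)) (length-descent k r))
           (shift (length w) (height (j ∷ S)) k (length r)))
  where
  shift : ∀ a b k c → a + b + suc (suc (k + suc c)) ≡ suc a + (k + suc b) + suc c
  shift = solve-∀

toUDFree-length : ∀ {w} → UUFreeFrom 0 w → length (toUDFree w) ≡ suc (length w)
toUDFree-length {w} p = begin
  length (reverse (encode (0 ∷ []) w [])) ≡⟨ length-reverse (encode (0 ∷ []) w []) ⟩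
  length (encode (0 ∷ []) w [])           ≡⟨ length-encode p (0 ∷ []) [] ⟩
  length w + 0 + 1                        ≡⟨ cong (_+ 1) (+-identityʳ (length w)) ⟩
  length w + 1                            ≡⟨ +-comm (length w) 1 ⟩
  suc (length w)                          ∎
  where open ≡-Reasoning

toUDFree-correct : ∀ w → MotzkinAvoiding UU w →
  length (toUDFree w) ≡ suc (length w) × MotzkinAvoiding UD (toUDFree w) ×
  finalDescent (toUDFree w) ≡ lowPeaks w × toUUFree (toUDFree w) ≡ w
toUDFree-correct w avoids =
  let avoidsDU , descent = RevUDFreeDescent⇒RevMotzkinAvoiding (encode-RevUDFreeDescent p (0 ∷ []) end) in
  toUDFree-length p ,
  Equivalence.from (MotzkinAvoiding-reverse U D (reverse u))
    (subst (RevMotzkinAvoiding DU) (sym (reverse-involutive u)) avoidsDU) ,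
  trans (cong leadingDs (reverse-involutive u)) descent ,
  trans (cong (decodeStart 0) (reverse-involutive u)) (decode-encode p (0 ∷ []) [])
  where
  p = Equivalence.from (UUFreeFrom⇔ 0 w) avoids
  u = encode (0 ∷ []) w []

decodeStart-correct : ∀ {k u} → RevUDFreeDescent k u →
  UUFreeFrom 0 (decodeStart 0 u) × encode (0 ∷ []) (decodeStart 0 u) [] ≡ u
decodeStart-correct (start {k} {v} q) =
  subst (UUFreeFrom 0) (sym (decodeStart-descent k v)) (decode-UUFreeFrom q end) ,
  trans (cong (λ x → encode (0 ∷ []) x []) (decodeStart-descent k v)) (encode-decode q [])

toUUFree-correct : ∀ y → MotzkinAvoiding UD y → 0 < length y →
  MotzkinAvoiding UU (toUUFree y) × toUDFree (toUUFree y) ≡ y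
toUUFree-correct y avoids nonempty =
  let p , e = decodeStart-correct (RevMotzkinAvoiding⇒RevUDFreeDescent (reverse y)
                (Equivalence.to (MotzkinAvoiding-reverse U D y) avoids)
                (subst (0 <_) (sym (length-reverse y)) nonempty))
  in Equivalence.to (UUFreeFrom⇔ 0 (toUUFree y)) p , trans (cong reverse e) (reverse-involutive y)

lowPeaks≡finalDescent : ∀ n k →
  countWith lowPeaks k (M n (UU ∷ [])) ≡ countWith finalDescent k (M (suc n) (UD ∷ []))
lowPeaks≡finalDescent n k = enumerates-length
  (countWith-enumerates lowPeaks k (M-enumerates n UU))
  (countWith-enumerates finalDescent k (M-enumerates (suc n) UD))
  toUDFree toUUFree forward backward
  where
  forward : ∀ {w} → InM n UU w × lowPeaks w ≡ k →
    (InM (suc n) UD (toUDFree w) × finalDescent (toUDFree w) ≡ k) × toUUFree (toUDFree w) ≡ w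
  forward {w} ((len , avoids) , peaks) =
    let len′ , avoids′ , descent , inverse = toUDFree-correct w avoids
    in ((trans len′ (cong suc len) , avoids′) , trans descent peaks) , inverse
  backward : ∀ {y} → InM (suc n) UD y × finalDescent y ≡ k →
    (InM n UU (toUUFree y) × lowPeaks (toUUFree y) ≡ k) × toUDFree (toUUFree y) ≡ y
  backward {y} ((len , avoids) , descent) =
    let avoids′ , inverse = toUUFree-correct y avoids (subst (0 <_) (sym len) z<s)
        len′ , _ , descent′ , _ = toUDFree-correct (toUUFree y) avoids′
    in ((suc-injective (trans (sym len′) (trans (cong length inverse) len)) , avoids′) ,
        trans (sym descent′) (trans (cong finalDescent inverse) descent)) , inverse

-- Final descent zero

dropLast : Word → Word
dropLast y = reverse (drop 1 (reverse y))

reverse-∷ʳ : ∀ (w : Word) s → reverse (w ∷ʳ s) ≡ s ∷ reverse w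
reverse-∷ʳ w s = reverse-++ w (s ∷ [])

length-∷ʳ : ∀ (w : Word) s → length (w ∷ʳ s) ≡ suc (length w)
length-∷ʳ w s = trans (length-++ w) (+-comm (length w) 1)

dropLast-∷ʳ : ∀ w s → dropLast (w ∷ʳ s) ≡ w
dropLast-∷ʳ w s = trans (cong (reverse ∘ drop 1) (reverse-∷ʳ w s)) (reverse-involutive w)

MotzkinAvoiding-∷ʳF : ∀ w → MotzkinAvoiding UD (w ∷ʳ F) ⇔ MotzkinAvoiding UD w
MotzkinAvoiding-∷ʳF w = ⇔.trans (MotzkinAvoiding-reverse U D (w ∷ʳ F))
  (⇔.trans (subst (λ u → RevMotzkinAvoiding DU u ⇔ RevMotzkinAvoiding DU (F ∷ reverse w))
                   (sym (reverse-∷ʳ w F)) ⇔.refl)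
           (⇔.sym (MotzkinAvoiding-reverse U D w)))

dropLast-∷ʳF : ∀ y → MotzkinAvoiding UD y → finalDescent y ≡ 0 → 0 < length y → dropLast y ∷ʳ F ≡ y
dropLast-∷ʳF y avoids descent nonempty =
  let v , e = endsWithF (reverse y) (proj₁ (Equivalence.to (MotzkinAvoiding-reverse U D y) avoids)) descent
                (subst (0 <_) (sym (length-reverse y)) nonempty)
  in begin
    dropLast y ∷ʳ F     ≡⟨ cong (λ u → reverse (drop 1 u) ∷ʳ F) e ⟩
    reverse v ∷ʳ F      ≡⟨ unfold-reverse F v ⟨
    reverse (F ∷ v)     ≡⟨ cong reverse e ⟨
    reverse (reverse y) ≡⟨ reverse-involutive y ⟩
    y                   ∎
  where
  open ≡-Reasoning
  endsWithF : ∀ u → walkBack 0 u ≡ just 0 → leadingDs u ≡ 0 → 0 < length u → ∃ λ v → u ≡ F ∷ v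
  endsWithF (F ∷ v) _ _ _ = v , refl

finalDescent-zero≡ : ∀ n → countWith finalDescent 0 (M (suc n) (UD ∷ [])) ≡ length (M n (UD ∷ []))
finalDescent-zero≡ n = enumerates-length
  (countWith-enumerates finalDescent 0 (M-enumerates (suc n) UD)) (M-enumerates n UD)
  dropLast (_∷ʳ F) forward backward
  where
  forward : ∀ {y} → InM (suc n) UD y × finalDescent y ≡ 0 → InM n UD (dropLast y) × dropLast y ∷ʳ F ≡ y
  forward {y} ((len , avoids) , descent) =
    let e = dropLast-∷ʳF y avoids descent (subst (0 <_) (sym len) z<s)
    in (suc-injective (trans (sym (length-∷ʳ (dropLast y) F)) (trans (cong length e) len)) ,
        Equivalence.to (MotzkinAvoiding-∷ʳF (dropLast y)) (subst (MotzkinAvoiding UD) (sym e) avoids)) , e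
  backward : ∀ {w} → InM n UD w →
    (InM (suc n) UD (w ∷ʳ F) × finalDescent (w ∷ʳ F) ≡ 0) × dropLast (w ∷ʳ F) ≡ w
  backward {w} (len , avoids) =
    ((trans (length-∷ʳ w F) (cong suc len) , Equivalence.from (MotzkinAvoiding-∷ʳF w) avoids) ,
     cong leadingDs (reverse-∷ʳ w F)) , dropLast-∷ʳ w F

mainTheorem3 : (n k : ℕ)
    → (countWith lowPeaks k (M n (UU ∷ [])) ≡ countWith finalDescent k (M (suc n) (UD ∷ [])))
    × (countWith lowPeaks 0 (M n (UU ∷ [])) ≡ length (M n (UD ∷ [])))
mainTheorem3 n k = lowPeaks≡finalDescent n k , trans (lowPeaks≡finalDescent n 0) (finalDescent-zero≡ n)
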